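{- For every $n\geq 3$, the bubble-sort graph $B_n={\rm Cay}(S_n,\{(1\,2),(2\,3),\dots,(n-1\,n)\})$ satisfies $D(B_n)=2$.
   Context: ${\rm Cay}(S_n,S)$ denotes the Cayley graph with vertex set the symmetric group $S_n$, where $h$ is adjacent to $sh$ for $h\in S_n$, $s\in S$. $D(G)$ is the distinguishing number: the least $r$ such that some vertex labeling of $G$ with $r$ labels is preserved by no non-identity automorphism of $G$. -}

module Defs where

open import Level using (0ℓ)
open import Data.Nat using (ℕ; zero; suc; _<_)
open import Data.Fin using (Fin; inject₁) renaming (suc to fsuc)
open import Data.Fin.Permutation using (Permutation′; _⟨$⟩ʳ_; transpose)
open import Data.List using (List; []; map; allFin)
open import Data.List.Membership.Propositional using (_∈_)
open import Data.Product using (Σ; ∃; _×_; _,_)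
open import Relation.Binary.PropositionalEquality using (_≡_)
open import Relation.Nullary using (¬_)

record Graph : Set₁ where
  field
    V    : Set
    _≈_  : V → V → Set
    Adj  : V → V → Set

record Automorphism (G : Graph) : Set where
  open Graph G
  field
    f          : V → V
    f-cong     : ∀ {a b} → a ≈ b → f a ≈ f b
    f-injective : ∀ {a b} → f a ≈ f b → a ≈ b
    f-surjective : ∀ b → ∃ λ a → f a ≈ b
    f-adj      : ∀ a b → Adj a b → Adj (f a) (f b)
    f-adj⁻     : ∀ a b → Adj (f a) (f b) → Adj a b

record Labeling (G : Graph) (r : ℕ) : Set where
  open Graph G
  field
    c      : V → Fin r
    c-cong : ∀ {a b} → a ≈ b → c a ≡ c b

Preserves : {G : Graph} {r : ℕ} → Automorphism G → Labeling G r → Set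
Preserves {G} φ L = ∀ a → c (f a) ≡ c a
  where open Automorphism φ; open Labeling L

IsIdentity : {G : Graph} → Automorphism G → Set
IsIdentity {G} φ = ∀ a → f a ≈ a
  where open Graph G; open Automorphism φ

IsDistinguishing : {G : Graph} {r : ℕ} → Labeling G r → Set
IsDistinguishing {G} L = (φ : Automorphism G) → Preserves φ L → IsIdentity φ

Distinguishable : Graph → ℕ → Set
Distinguishable G r = Σ (Labeling G r) IsDistinguishing

DistinguishingNumber≡ : Graph → ℕ → Set
DistinguishingNumber≡ G r = Distinguishable G r × (∀ m → m < r → ¬ Distinguishable G m)

-- Cayley graph Cay(S_n, S): vertices are permutations of Fin n (up to pointwise
-- equality), h adjacent to g iff g = s h (i.e. g(x) = s(h(x))) for some s ∈ S.
Cay : (n : ℕ) → List (Permutation′ n) → Graph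
Cay n S = record
  { V   = Permutation′ n
  ; _≈_ = λ g h → ∀ i → g ⟨$⟩ʳ i ≡ h ⟨$⟩ʳ i
  ; Adj = λ h g → Σ (Permutation′ n) λ s → s ∈ S × (∀ x → g ⟨$⟩ʳ x ≡ s ⟨$⟩ʳ (h ⟨$⟩ʳ x))
  }

-- The adjacent transpositions (1 2), (2 3), ..., (n-1 n), on Fin n = {0,...,n-1}.
adjTranspositions : (n : ℕ) → List (Permutation′ n)
adjTranspositions zero    = []
adjTranspositions (suc m) = map (λ i → transpose (inject₁ i) (fsuc i)) (allFin m)

BubbleSort : ℕ → Graph
BubbleSort n = Cay n (adjTranspositions n)

-- Label e, s₀ = (0 1) and x = (0 2) by 1 and every other permutation by 0.  A
-- label-preserving automorphism φ fixes x, the only vertex of label 1 with no neighbour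
-- of label 1; then e, since e and x have no common neighbour while s₀ and x do; then s₀,
-- and then the neighbours of e one generator at a time.  Rigidity spreads from a vertex g
-- fixed together with its neighbours to every neighbour s_i g: for j far from i the vertex
-- s_j s_i g is the only common neighbour of s_i g and s_j g besides g, and for j next to i
-- it is pinned by the squares through the generators beyond j (by a braid hexagon when
-- n = 4).  As B_n is connected, φ is the identity.  One label is too few, because
-- g ↦ g ∘ π is an automorphism of every Cayley graph.

module Submission where

open import Defs
open import Data.Empty using (⊥; ⊥-elim)
open import Data.Fin as Fin using (Fin; toℕ; inject₁; fromℕ<) renaming (zero to fzero; suc to fsuc)
open import Data.Fin.Properties using (toℕ-inject₁; toℕ-injective; toℕ-fromℕ<; toℕ<n; all?; 0≢1+n)
open import Data.Fin.Permutation
  using (Permutation′; _⟨$⟩ʳ_; _⟨$⟩ˡ_; transpose; _∘ₚ_; inverseʳ; inverseˡ; flip) renaming (id to idₚ)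
import Data.Fin.Permutation.Transposition.List as TL
open import Data.List using (List; []; _∷_; map)
open import Data.List.Membership.Propositional.Properties using (∈-map⁺; ∈-map⁻; ∈-allFin)
open import Data.Nat using (ℕ; zero; suc; _+_; _<_; _≤_; z≤n; s≤s; _≟_; _<?_)
open import Data.Nat.Properties
  using (<-irrefl; <-trans; <-cmp; n<1+n; suc-injective; ≤∧≢⇒<; ≮⇒≥; ≤-trans; ≤-refl; ≤-reflexive; <⇒≢; >⇒≢;
         <⇒≤; ≤-pred; ≤-antisym; m≤n⇒m≤1+n; m<n⇒m<1+n; m≤m+n; m≤n⇒m<n∨m≡n; m≤n⇒∃[o]m+o≡n; +-identityʳ; +-suc)
open import Data.Product using (∃; _×_; _,_; proj₁; proj₂)
open import Data.Sum using (_⊎_; inj₁; inj₂)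
open import Function using (_∘_; _∘′_)
open import Relation.Binary.Definitions using (tri<; tri≈; tri>)
open import Relation.Binary.PropositionalEquality
open import Relation.Nullary using (¬_; Dec; yes; no; _⊎-dec_)
open import Relation.Nullary.Decidable using (map′)

open ≡-Reasoning

τ : ℕ → ℕ → ℕ
τ zero    zero          = 1
τ zero    (suc zero)    = 0
τ zero    (suc (suc y)) = suc (suc y)
τ (suc k) zero          = zero
τ (suc k) (suc y)       = suc (τ k y)

τ-left : ∀ k → τ k k ≡ suc k
τ-left zero    = refl
τ-left (suc k) = cong suc (τ-left k)

τ-right : ∀ k → τ k (suc k) ≡ k
τ-right zero    = refl
τ-right (suc k) = cong suc (τ-right k)

τ-involutive : ∀ k y → τ k (τ k y) ≡ y
τ-involutive zero    zero          = refl
τ-involutive zero    (suc zero)    = refl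
τ-involutive zero    (suc (suc y)) = refl
τ-involutive (suc k) zero          = refl
τ-involutive (suc k) (suc y)       = cong suc (τ-involutive k y)

τ-fixes : ∀ k y → k ≢ y → suc k ≢ y → τ k y ≡ y
τ-fixes zero    zero          k≢y _    = ⊥-elim (k≢y refl)
τ-fixes zero    (suc zero)    _   sk≢y = ⊥-elim (sk≢y refl)
τ-fixes zero    (suc (suc y)) _   _    = refl
τ-fixes (suc k) zero          _   _    = refl
τ-fixes (suc k) (suc y)       k≢y sk≢y =
  cong suc (τ-fixes k y (k≢y ∘′ cong suc) (sk≢y ∘′ cong suc))

<τ⇒≡ : ∀ k y → y < τ k y → k ≡ y
<τ⇒≡ zero    zero          _       = refl
<τ⇒≡ zero    (suc (suc y)) y<y     = ⊥-elim (<-irrefl refl y<y)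
<τ⇒≡ (suc k) (suc y)       (s≤s p) = cong suc (<τ⇒≡ k y p)

τ<⇒suc≡ : ∀ k y → τ k y < y → suc k ≡ y
τ<⇒suc≡ zero    (suc zero)    _       = refl
τ<⇒suc≡ zero    (suc (suc y)) y<y     = ⊥-elim (<-irrefl refl y<y)
τ<⇒suc≡ (suc k) (suc y)       (s≤s p) = cong suc (τ<⇒suc≡ k y p)

τ-comm : ∀ a b → suc a < b → ∀ y → τ a (τ b y) ≡ τ b (τ a y)
τ-comm zero    (suc zero)    (s≤s ()) _
τ-comm zero    (suc (suc b)) _       zero          = refl
τ-comm zero    (suc (suc b)) _       (suc zero)    = refl
τ-comm zero    (suc (suc b)) _       (suc (suc y)) = refl
τ-comm (suc a) (suc b)       _       zero          = refl
τ-comm (suc a) (suc b)       (s≤s p) (suc y)       = cong suc (τ-comm a b p y)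

τ-braid : ∀ k y → τ k (τ (suc k) (τ k y)) ≡ τ (suc k) (τ k (τ (suc k) y))
τ-braid zero    zero                = refl
τ-braid zero    (suc zero)          = refl
τ-braid zero    (suc (suc zero))    = refl
τ-braid zero    (suc (suc (suc y))) = refl
τ-braid (suc k) zero                = refl
τ-braid (suc k) (suc y)             = cong suc (τ-braid k y)

Near : ℕ → ℕ → Set
Near a b = suc a ≡ b ⊎ suc b ≡ a

Far : ℕ → ℕ → Set
Far a b = suc a < b ⊎ suc b < a

Far-sym : ∀ {a b} → Far a b → Far b a
Far-sym (inj₁ p) = inj₂ p
Far-sym (inj₂ p) = inj₁ p

Near⇒≢ : ∀ {a b} → Near a b → a ≢ b
Near⇒≢ (inj₁ p) refl = <-irrefl (sym p) (n<1+n _)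
Near⇒≢ (inj₂ p) refl = <-irrefl (sym p) (n<1+n _)

Far⇒≢ : ∀ {a b} → Far a b → a ≢ b
Far⇒≢ (inj₁ p) refl = <-irrefl refl (<-trans (n<1+n _) p)
Far⇒≢ (inj₂ p) refl = <-irrefl refl (<-trans (n<1+n _) p)

Near⇒¬Far : ∀ {a b} → Near a b → ¬ Far a b
Near⇒¬Far (inj₁ refl) (inj₁ p) = <-irrefl refl p
Near⇒¬Far (inj₁ refl) (inj₂ p) = <-irrefl refl (<-trans (n<1+n _) (<-trans (n<1+n _) p))
Near⇒¬Far (inj₂ refl) (inj₁ p) = <-irrefl refl (<-trans (n<1+n _) (<-trans (n<1+n _) p))
Near⇒¬Far (inj₂ refl) (inj₂ p) = <-irrefl refl p

≡⊎Near⊎Far : ∀ a b → a ≡ b ⊎ Near a b ⊎ Far a b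
≡⊎Near⊎Far a b with <-cmp a b
... | tri≈ _ a≡b _ = inj₁ a≡b
... | tri< a<b _ _ with suc a ≟ b
...   | yes sa≡b = inj₂ (inj₁ (inj₁ sa≡b))
...   | no  sa≢b = inj₂ (inj₂ (inj₁ (≤∧≢⇒< a<b sa≢b)))
≡⊎Near⊎Far a b | tri> _ _ b<a with suc b ≟ a
...   | yes sb≡a = inj₂ (inj₁ (inj₂ sb≡a))
...   | no  sb≢a = inj₂ (inj₂ (inj₂ (≤∧≢⇒< b<a sb≢a)))

≤⇒Far : ∀ {a b} → suc (suc a) ≤ b → Far b a
≤⇒Far = inj₂

Near-other-above : ∀ {a b c} → suc a ≡ b → Near c b → c ≢ a → c ≡ suc b
Near-other-above sa≡b (inj₁ sc≡b) c≢a = ⊥-elim (c≢a (suc-injective (trans sc≡b (sym sa≡b))))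
Near-other-above _    (inj₂ sb≡c) _   = sym sb≡c

Near-other-below : ∀ {a b c} → a ≡ suc b → Near c b → c ≢ a → suc c ≡ b
Near-other-below _   (inj₁ sc≡b) _   = sc≡b
Near-other-below a≡sb (inj₂ sb≡c) c≢a = ⊥-elim (c≢a (trans (sym sb≡c) (sym a≡sb)))

τ-square-< : ∀ n a b c d → a < b → b < n →
             (∀ y → y < n → τ c (τ a y) ≡ τ d (τ b y)) →
             (c ≡ a × d ≡ b) ⊎ (c ≡ b × d ≡ a × suc a < b)
τ-square-< n a b c d a<b b<n E with c ≟ a
... | yes refl = inj₁ (refl , suc-injective (τ<⇒suc≡ d (suc b) τd[sb]<sb))
  where
  τd[sb]<sb : τ d (suc b) < suc b
  τd[sb]<sb = subst (_< suc b) (begin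
    b                  ≡⟨ sym (τ-involutive c b) ⟩
    τ c (τ c b)        ≡⟨ E b b<n ⟩
    τ d (τ b b)        ≡⟨ cong (τ d) (τ-left b) ⟩
    τ d (suc b)        ∎) (n<1+n b)
... | no c≢a = inj₂ (c≡b , d≡a , sa<b)
  where
  d≡a : d ≡ a
  d≡a = <τ⇒≡ d a (≤-trans sa≤τc[sa] (≤-reflexive (begin
    τ c (suc a)      ≡⟨ cong (τ c) (sym (τ-left a)) ⟩
    τ c (τ a a)      ≡⟨ E a (<-trans a<b b<n) ⟩
    τ d (τ b a)      ≡⟨ cong (τ d) (τ-fixes b a (>⇒≢ a<b) (>⇒≢ (<-trans a<b (n<1+n b)))) ⟩
    τ d a            ∎)))
    where
    sa≤τc[sa] : suc a ≤ τ c (suc a)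
    sa≤τc[sa] = ≮⇒≥ (λ lt → c≢a (suc-injective (τ<⇒suc≡ c (suc a) lt)))
  τc[τab]≡sb : τ c (τ a b) ≡ suc b
  τc[τab]≡sb = begin
    τ c (τ a b)      ≡⟨ E b b<n ⟩
    τ d (τ b b)      ≡⟨ cong₂ τ d≡a (τ-left b) ⟩
    τ a (suc b)      ≡⟨ τ-fixes a (suc b) (<⇒≢ (<-trans a<b (n<1+n b))) (<⇒≢ (s≤s a<b)) ⟩
    suc b            ∎
  sa<b : suc a < b
  sa<b with suc a ≟ b
  ... | no sa≢b  = ≤∧≢⇒< a<b sa≢b
  ... | yes refl = ⊥-elim (c≢a (<τ⇒≡ c a (subst (a <_) (sym τca≡ssa) (<-trans (n<1+n a) (n<1+n (suc a))))))
    where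
    τca≡ssa : τ c a ≡ suc (suc a)
    τca≡ssa = trans (cong (τ c) (sym (τ-right a))) τc[τab]≡sb
  c≡b : c ≡ b
  c≡b = <τ⇒≡ c b (subst (b <_) (sym τcb≡sb) (n<1+n b))
    where
    τcb≡sb : τ c b ≡ suc b
    τcb≡sb = trans (cong (τ c) (sym (τ-fixes a b (<⇒≢ a<b) (<⇒≢ sa<b)))) τc[τab]≡sb

τ-square : ∀ n a b c d → a ≢ b → a < n → b < n →
           (∀ y → y < n → τ c (τ a y) ≡ τ d (τ b y)) →
           (c ≡ a × d ≡ b) ⊎ (c ≡ b × d ≡ a × Far a b)
τ-square n a b c d a≢b a<n b<n E with <-cmp a b
... | tri≈ _ a≡b _ = ⊥-elim (a≢b a≡b)
... | tri< a<b _ _ with τ-square-< n a b c d a<b b<n E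
...   | inj₁ eqs             = inj₁ eqs
...   | inj₂ (c≡b , d≡a , F) = inj₂ (c≡b , d≡a , inj₁ F)
τ-square n a b c d a≢b a<n b<n E | tri> _ _ b<a with τ-square-< n b a d c b<a a<n (λ y y<n → sym (E y y<n))
...   | inj₁ (d≡b , c≡a)     = inj₁ (c≡a , d≡b)
...   | inj₂ (d≡a , c≡b , F) = inj₂ (c≡b , d≡a , inj₂ F)

swap : ℕ → ℕ → ℕ → ℕ
swap p q y with y ≟ p | y ≟ q
... | yes _ | _     = q
... | no _  | yes _ = p
... | no _  | no _  = y

swap-left : ∀ p q → swap p q p ≡ q
swap-left p q with p ≟ p
... | yes _   = refl
... | no p≢p  = ⊥-elim (p≢p refl)

swap-right : ∀ p q → p ≢ q → swap p q q ≡ p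
swap-right p q p≢q with q ≟ p | q ≟ q
... | yes q≡p | _       = ⊥-elim (p≢q (sym q≡p))
... | no _    | yes _   = refl
... | no _    | no q≢q  = ⊥-elim (q≢q refl)

swap-fixes : ∀ p q y → y ≢ p → y ≢ q → swap p q y ≡ y
swap-fixes p q y y≢p y≢q with y ≟ p | y ≟ q
... | yes y≡p | _       = ⊥-elim (y≢p y≡p)
... | no _    | yes y≡q = ⊥-elim (y≢q y≡q)
... | no _    | no _    = refl

swap-same : ∀ p y → swap p p y ≡ y
swap-same p y with y ≟ p
... | yes refl = refl
... | no _     = refl

swap-comm : ∀ p q y → swap p q y ≡ swap q p y
swap-comm p q y with y ≟ p | y ≟ q
... | yes refl | yes refl = refl
... | yes refl | no _     = refl
... | no _     | yes refl = refl
... | no _     | no _     = refl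

τ≗swap : ∀ k y → τ k y ≡ swap k (suc k) y
τ≗swap k y with y ≟ k | y ≟ suc k
... | yes refl | _        = τ-left y
... | no _     | yes refl = τ-right k
... | no y≢k   | no y≢sk  = τ-fixes k y (y≢k ∘′ sym) (y≢sk ∘′ sym)

swap-conj : ∀ p q y → suc p < q → swap p q y ≡ τ p (swap (suc p) q (τ p y))
swap-conj p q y sp<q with y ≟ p | y ≟ q
... | yes refl | _ = sym (begin
  τ y (swap (suc y) q (τ y y))     ≡⟨ cong (λ z → τ y (swap (suc y) q z)) (τ-left y) ⟩
  τ y (swap (suc y) q (suc y))     ≡⟨ cong (τ y) (swap-left (suc y) q) ⟩
  τ y q                            ≡⟨ τ-fixes y q (<⇒≢ (<-trans (n<1+n y) sp<q)) (<⇒≢ sp<q) ⟩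
  q                                ∎)
... | no _ | yes refl = sym (begin
  τ p (swap (suc p) y (τ p y))       ≡⟨ cong (λ z → τ p (swap (suc p) y z)) (τ-fixes p y p≢q (<⇒≢ sp<q)) ⟩
  τ p (swap (suc p) y y)             ≡⟨ cong (τ p) (swap-right (suc p) y (<⇒≢ sp<q)) ⟩
  τ p (suc p)                        ≡⟨ τ-right p ⟩
  p                                  ∎)
  where
  p≢q : p ≢ y
  p≢q = <⇒≢ (<-trans (n<1+n p) sp<q)
... | no y≢p | no y≢q with y ≟ suc p
...   | yes refl = sym (begin
  τ p (swap (suc p) q (τ p (suc p))) ≡⟨ cong (λ z → τ p (swap (suc p) q z)) (τ-right p) ⟩
  τ p (swap (suc p) q p)             ≡⟨ cong (τ p) (swap-fixes (suc p) q p (<⇒≢ (n<1+n p))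
                                                                  (<⇒≢ (<-trans (n<1+n p) sp<q))) ⟩
  τ p p                              ≡⟨ τ-left p ⟩
  suc p                              ∎)
...   | no y≢sp = sym (begin
  τ p (swap (suc p) q (τ p y))       ≡⟨ cong (λ z → τ p (swap (suc p) q z)) τpy≡y ⟩
  τ p (swap (suc p) q y)             ≡⟨ cong (τ p) (swap-fixes (suc p) q y y≢sp y≢q) ⟩
  τ p y                              ≡⟨ τpy≡y ⟩
  y                                  ∎)
  where
  τpy≡y : τ p y ≡ y
  τpy≡y = τ-fixes p y (y≢p ∘′ sym) (y≢sp ∘′ sym)

toℕ-transpose : ∀ {n} (i j x : Fin n) → toℕ (transpose i j ⟨$⟩ʳ x) ≡ swap (toℕ i) (toℕ j) (toℕ x)
toℕ-transpose i j x with x Fin.≟ i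
... | yes refl = sym (swap-left (toℕ x) (toℕ j))
... | no x≢i with x Fin.≟ j
...   | yes refl = sym (swap-right (toℕ i) (toℕ x) (x≢i ∘ sym ∘ toℕ-injective))
...   | no x≢j   = sym (swap-fixes (toℕ i) (toℕ j) (toℕ x) (x≢i ∘ toℕ-injective) (x≢j ∘ toℕ-injective))

τ* : List ℕ → ℕ → ℕ
τ* []      y = y
τ* (k ∷ w) y = τ k (τ* w y)

module BubbleSortGraph (m : ℕ) where

  V : Set
  V = Permutation′ (suc m)

  -- The vertex equality of BubbleSort, wrapped in a record so that Agda can infer
  -- g and h from a proof of g ≃ h.
  infix 4 _≃_
  record _≃_ (g h : V) : Set where
    constructor mk≃
    field ap : ∀ x → g ⟨$⟩ʳ x ≡ h ⟨$⟩ʳ x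
  open _≃_ public

  ≃-refl : ∀ {g} → g ≃ g
  ≃-refl = mk≃ λ _ → refl

  ≃-sym : ∀ {g h} → g ≃ h → h ≃ g
  ≃-sym g≃h = mk≃ λ x → sym (ap g≃h x)

  ≃-trans : ∀ {g h k} → g ≃ h → h ≃ k → g ≃ k
  ≃-trans g≃h h≃k = mk≃ λ x → trans (ap g≃h x) (ap h≃k x)

  ≃-via-toℕ : ∀ {g h} → (∀ x → toℕ (g ⟨$⟩ʳ x) ≡ toℕ (h ⟨$⟩ʳ x)) → g ≃ h
  ≃-via-toℕ E = mk≃ (toℕ-injective ∘ E)

  gen : Fin m → V
  gen i = transpose (inject₁ i) (fsuc i)

  toℕ-gen : ∀ i x → toℕ (gen i ⟨$⟩ʳ x) ≡ τ (toℕ i) (toℕ x)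
  toℕ-gen i x = begin
    toℕ (gen i ⟨$⟩ʳ x)                          ≡⟨ toℕ-transpose (inject₁ i) (fsuc i) x ⟩
    swap (toℕ (inject₁ i)) (suc (toℕ i)) (toℕ x) ≡⟨ cong (λ p → swap p (suc (toℕ i)) (toℕ x)) (toℕ-inject₁ i) ⟩
    swap (toℕ i) (suc (toℕ i)) (toℕ x)           ≡⟨ sym (τ≗swap (toℕ i) (toℕ x)) ⟩
    τ (toℕ i) (toℕ x)                            ∎

  -- nbr i g = (i i+1) ∘ g, the i-th neighbour of g (_∘ₚ_ composes diagrammatically).
  -- Opaque, because unfolding _∘ₚ_ leaves unification problems unsolved.
  opaque
    nbr : Fin m → V → V
    nbr i g = g ∘ₚ gen i

    nbr-ap : ∀ i g x → nbr i g ⟨$⟩ʳ x ≡ gen i ⟨$⟩ʳ (g ⟨$⟩ʳ x)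
    nbr-ap i g x = refl

  nbr* : List (Fin m) → V → V
  nbr* []      g = g
  nbr* (i ∷ w) g = nbr i (nbr* w g)

  nbr-cong : ∀ {g h} i → g ≃ h → nbr i g ≃ nbr i h
  nbr-cong {g} {h} i g≃h = mk≃ λ x →
    trans (nbr-ap i g x) (trans (cong (gen i ⟨$⟩ʳ_) (ap g≃h x)) (sym (nbr-ap i h x)))

  nbr⇒Adj : ∀ {g h} i → g ≃ nbr i h → Graph.Adj (BubbleSort (suc m)) h g
  nbr⇒Adj {g} {h} i g≃ih = gen i , ∈-map⁺ _ (∈-allFin i) , λ x → trans (ap g≃ih x) (nbr-ap i h x)

  Adj⇒nbr : ∀ {g h} → Graph.Adj (BubbleSort (suc m)) h g → ∃ λ i → g ≃ nbr i h
  Adj⇒nbr (s , s∈S , E) with ∈-map⁻ _ s∈S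
  ... | i , _ , refl = i , mk≃ λ x → trans (E x) (sym (nbr-ap i _ x))

  toℕ-nbr : ∀ i g x → toℕ (nbr i g ⟨$⟩ʳ x) ≡ τ (toℕ i) (toℕ (g ⟨$⟩ʳ x))
  toℕ-nbr i g x = trans (cong toℕ (nbr-ap i g x)) (toℕ-gen i (g ⟨$⟩ʳ x))

  toℕ-nbr* : ∀ w g x → toℕ (nbr* w g ⟨$⟩ʳ x) ≡ τ* (map toℕ w) (toℕ (g ⟨$⟩ʳ x))
  toℕ-nbr* []      g x = refl
  toℕ-nbr* (i ∷ w) g x = trans (toℕ-nbr i (nbr* w g) x) (cong (τ (toℕ i)) (toℕ-nbr* w g x))

  nbr*-≃⇒τ*-≗ : ∀ w w′ g → nbr* w g ≃ nbr* w′ g →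
                ∀ y → y < suc m → τ* (map toℕ w) y ≡ τ* (map toℕ w′) y
  nbr*-≃⇒τ*-≗ w w′ g E y y<sm = begin
    τ* (map toℕ w) y                ≡⟨ cong (τ* (map toℕ w)) (sym g[x]≡y) ⟩
    τ* (map toℕ w) (toℕ (g ⟨$⟩ʳ x))  ≡⟨ sym (toℕ-nbr* w g x) ⟩
    toℕ (nbr* w g ⟨$⟩ʳ x)            ≡⟨ cong toℕ (ap E x) ⟩
    toℕ (nbr* w′ g ⟨$⟩ʳ x)           ≡⟨ toℕ-nbr* w′ g x ⟩
    τ* (map toℕ w′) (toℕ (g ⟨$⟩ʳ x)) ≡⟨ cong (τ* (map toℕ w′)) g[x]≡y ⟩
    τ* (map toℕ w′) y               ∎
    where
    x : Fin (suc m)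
    x = g ⟨$⟩ˡ fromℕ< y<sm
    g[x]≡y : toℕ (g ⟨$⟩ʳ x) ≡ y
    g[x]≡y = trans (cong toℕ (inverseʳ g)) (toℕ-fromℕ< y<sm)

  τ*-≗⇒nbr*-≃ : ∀ w w′ g → (∀ y → y < suc m → τ* (map toℕ w) y ≡ τ* (map toℕ w′) y) →
                nbr* w g ≃ nbr* w′ g
  τ*-≗⇒nbr*-≃ w w′ g E = ≃-via-toℕ λ x → begin
    toℕ (nbr* w g ⟨$⟩ʳ x)            ≡⟨ toℕ-nbr* w g x ⟩
    τ* (map toℕ w) (toℕ (g ⟨$⟩ʳ x))  ≡⟨ E _ (toℕ<n (g ⟨$⟩ʳ x)) ⟩
    τ* (map toℕ w′) (toℕ (g ⟨$⟩ʳ x)) ≡⟨ sym (toℕ-nbr* w′ g x) ⟩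
    toℕ (nbr* w′ g ⟨$⟩ʳ x)           ∎

  toℕ<suc-m : (i : Fin m) → toℕ i < suc m
  toℕ<suc-m i = m<n⇒m<1+n (toℕ<n i)

  nbr-involutive : ∀ i g → nbr i (nbr i g) ≃ g
  nbr-involutive i g = τ*-≗⇒nbr*-≃ (i ∷ i ∷ []) [] g (λ y _ → τ-involutive (toℕ i) y)

  nbr-≄ : ∀ {i g} → ¬ nbr i g ≃ g
  nbr-≄ {i} {g} E = <-irrefl (sym τii≡i) (n<1+n (toℕ i))
    where
    τii≡i : suc (toℕ i) ≡ toℕ i
    τii≡i = trans (sym (τ-left (toℕ i))) (nbr*-≃⇒τ*-≗ (i ∷ []) [] g E (toℕ i) (toℕ<suc-m i))

  nbr-injectiveˡ : ∀ {a b g} → nbr a g ≃ nbr b g → a ≡ b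
  nbr-injectiveˡ {a} {b} {g} E = toℕ-injective (sym (<τ⇒≡ (toℕ b) (toℕ a) (subst (toℕ a <_) sa≡τba (n<1+n (toℕ a)))))
    where
    sa≡τba : suc (toℕ a) ≡ τ (toℕ b) (toℕ a)
    sa≡τba = trans (sym (τ-left (toℕ a))) (nbr*-≃⇒τ*-≗ (a ∷ []) (b ∷ []) g E (toℕ a) (toℕ<suc-m a))

  nbr-comm : ∀ {a b} g → Far (toℕ a) (toℕ b) → nbr a (nbr b g) ≃ nbr b (nbr a g)
  nbr-comm {a} {b} g (inj₁ sa<b) =
    τ*-≗⇒nbr*-≃ (a ∷ b ∷ []) (b ∷ a ∷ []) g (λ y _ → τ-comm (toℕ a) (toℕ b) sa<b y)
  nbr-comm {a} {b} g (inj₂ sb<a) =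
    τ*-≗⇒nbr*-≃ (a ∷ b ∷ []) (b ∷ a ∷ []) g (λ y _ → sym (τ-comm (toℕ b) (toℕ a) sb<a y))

  nbr-nbr-≄ : ∀ {a b g} → a ≢ b → ¬ nbr a (nbr b g) ≃ g
  nbr-nbr-≄ {a} {b} {g} a≢b E = a≢b (nbr-injectiveˡ (≃-trans E (≃-sym (nbr-involutive b g))))

  nbr-square : ∀ {a b c d g} → a ≢ b → nbr c (nbr a g) ≃ nbr d (nbr b g) →
               (c ≡ a × d ≡ b) ⊎ (c ≡ b × d ≡ a × Far (toℕ a) (toℕ b))
  nbr-square {a} {b} {c} {d} {g} a≢b E
    with τ-square (suc m) (toℕ a) (toℕ b) (toℕ c) (toℕ d) (a≢b ∘ toℕ-injective) (toℕ<suc-m a) (toℕ<suc-m b)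
           (nbr*-≃⇒τ*-≗ (c ∷ a ∷ []) (d ∷ b ∷ []) g E)
  ... | inj₁ (c≡a , d≡b)     = inj₁ (toℕ-injective c≡a , toℕ-injective d≡b)
  ... | inj₂ (c≡b , d≡a , F) = inj₂ (toℕ-injective c≡b , toℕ-injective d≡a , F)

  nbr-braid : ∀ {c i} g → toℕ i ≡ suc (toℕ c) → nbr c (nbr i (nbr c g)) ≃ nbr i (nbr c (nbr i g))
  nbr-braid {c} {i} g i≡sc = τ*-≗⇒nbr*-≃ (c ∷ i ∷ c ∷ []) (i ∷ c ∷ i ∷ []) g λ y _ →
    subst (λ v → τ (toℕ c) (τ v (τ (toℕ c) y)) ≡ τ v (τ (toℕ c) (τ v y))) (sym i≡sc) (τ-braid (toℕ c) y)

  toℕ-∘ₚ-transpose : ∀ (g : V) (p q : Fin (suc m)) x →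
                     toℕ ((g ∘ₚ transpose p q) ⟨$⟩ʳ x) ≡ swap (toℕ p) (toℕ q) (toℕ (g ⟨$⟩ʳ x))
  toℕ-∘ₚ-transpose g p q x = toℕ-transpose p q (g ⟨$⟩ʳ x)

  ∘ₚ-transpose-same : ∀ (g : V) p → g ∘ₚ transpose p p ≃ g
  ∘ₚ-transpose-same g p = ≃-via-toℕ λ x → trans (toℕ-∘ₚ-transpose g p p x) (swap-same (toℕ p) (toℕ (g ⟨$⟩ʳ x)))

  ∘ₚ-transpose-comm : ∀ (g : V) p q → g ∘ₚ transpose p q ≃ g ∘ₚ transpose q p
  ∘ₚ-transpose-comm g p q = ≃-via-toℕ λ x → begin
    toℕ ((g ∘ₚ transpose p q) ⟨$⟩ʳ x)        ≡⟨ toℕ-∘ₚ-transpose g p q x ⟩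
    swap (toℕ p) (toℕ q) (toℕ (g ⟨$⟩ʳ x))   ≡⟨ swap-comm (toℕ p) (toℕ q) (toℕ (g ⟨$⟩ʳ x)) ⟩
    swap (toℕ q) (toℕ p) (toℕ (g ⟨$⟩ʳ x))   ≡⟨ sym (toℕ-∘ₚ-transpose g q p x) ⟩
    toℕ ((g ∘ₚ transpose q p) ⟨$⟩ʳ x)        ∎

  ∘ₚ-transpose-gen : ∀ (g : V) i p q → toℕ p ≡ toℕ i → toℕ q ≡ suc (toℕ i) → g ∘ₚ transpose p q ≃ nbr i g
  ∘ₚ-transpose-gen g i p q p≡i q≡si = ≃-via-toℕ λ x → begin
    toℕ ((g ∘ₚ transpose p q) ⟨$⟩ʳ x)        ≡⟨ toℕ-∘ₚ-transpose g p q x ⟩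
    swap (toℕ p) (toℕ q) (toℕ (g ⟨$⟩ʳ x))   ≡⟨ cong₂ (λ u v → swap u v (toℕ (g ⟨$⟩ʳ x))) p≡i q≡si ⟩
    swap (toℕ i) (suc (toℕ i)) (toℕ (g ⟨$⟩ʳ x)) ≡⟨ sym (τ≗swap (toℕ i) (toℕ (g ⟨$⟩ʳ x))) ⟩
    τ (toℕ i) (toℕ (g ⟨$⟩ʳ x))               ≡⟨ sym (toℕ-nbr i g x) ⟩
    toℕ (nbr i g ⟨$⟩ʳ x)                     ∎

  ∘ₚ-transpose-conj : ∀ (g : V) i p p′ q → toℕ p ≡ toℕ i → toℕ p′ ≡ suc (toℕ i) → suc (toℕ p) < toℕ q →
                      g ∘ₚ transpose p q ≃ nbr i (nbr i g ∘ₚ transpose p′ q)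
  ∘ₚ-transpose-conj g i p p′ q p≡i p′≡si sp<q = ≃-via-toℕ pointwise
    where
    pointwise : ∀ x → toℕ ((g ∘ₚ transpose p q) ⟨$⟩ʳ x) ≡ toℕ (nbr i (nbr i g ∘ₚ transpose p′ q) ⟨$⟩ʳ x)
    pointwise x = begin
      toℕ ((g ∘ₚ transpose p q) ⟨$⟩ʳ x)                       ≡⟨ toℕ-∘ₚ-transpose g p q x ⟩
      swap (toℕ p) (toℕ q) y                                 ≡⟨ swap-conj (toℕ p) (toℕ q) y sp<q ⟩
      τ (toℕ p) (swap (suc (toℕ p)) (toℕ q) (τ (toℕ p) y))    ≡⟨ cong (λ u → τ u (swap (suc u) (toℕ q) (τ u y))) p≡i ⟩
      τ (toℕ i) (swap (suc (toℕ i)) (toℕ q) (τ (toℕ i) y))    ≡⟨ cong₂ (λ u v → τ (toℕ i) (swap u (toℕ q) v))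
                                                                   (sym p′≡si) (sym (toℕ-nbr i g x)) ⟩
      τ (toℕ i) (swap (toℕ p′) (toℕ q) (toℕ (nbr i g ⟨$⟩ʳ x))) ≡⟨ cong (τ (toℕ i))
                                                                   (sym (toℕ-∘ₚ-transpose (nbr i g) p′ q x)) ⟩
      τ (toℕ i) (toℕ ((nbr i g ∘ₚ transpose p′ q) ⟨$⟩ʳ x))    ≡⟨ sym (toℕ-nbr i (nbr i g ∘ₚ transpose p′ q) x) ⟩
      toℕ (nbr i (nbr i g ∘ₚ transpose p′ q) ⟨$⟩ʳ x)         ∎
      where
      y : ℕ
      y = toℕ (g ⟨$⟩ʳ x)

no-τ-hexagon : ∀ {l i c} → l ≡ 2 → i ≡ 1 → c ≡ 0 →
               ∀ a b → ¬ (∀ y → y < 4 → τ a (τ l (τ i y)) ≡ τ b (τ i (τ c y)))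
no-τ-hexagon refl refl refl zero          zero          E with E 0 (s≤s z≤n)
... | ()
no-τ-hexagon refl refl refl zero          (suc zero)    E with E 3 (s≤s (s≤s (s≤s (s≤s z≤n))))
... | ()
no-τ-hexagon refl refl refl zero          (suc (suc b)) E with E 0 (s≤s z≤n)
... | ()
no-τ-hexagon refl refl refl (suc a)       zero          E with E 0 (s≤s z≤n)
... | ()
no-τ-hexagon refl refl refl (suc a)       (suc zero)    E with E 0 (s≤s z≤n)
... | ()
no-τ-hexagon refl refl refl (suc a)       (suc (suc b)) E with E 0 (s≤s z≤n)
... | ()

module Rigidity (m : ℕ) (φ : Automorphism (BubbleSort (suc m))) where

  open BubbleSortGraph m
  open Automorphism φ

  f-≃ : ∀ {g h} → g ≃ h → f g ≃ f h
  f-≃ g≃h = mk≃ (f-cong (ap g≃h))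

  f-≃⁻ : ∀ {g h} → f g ≃ f h → g ≃ h
  f-≃⁻ fg≃fh = mk≃ (f-injective (ap fg≃fh))

  f-surj : ∀ h → ∃ λ g → f g ≃ h
  f-surj h with f-surjective h
  ... | g , fg≈h = g , mk≃ fg≈h

  f-nbr : ∀ i g → ∃ λ l → f (nbr i g) ≃ nbr l (f g)
  f-nbr i g = Adj⇒nbr (f-adj g (nbr i g) (nbr⇒Adj i ≃-refl))

  f-nbr⁻ : ∀ {g h i} → f g ≃ nbr i (f h) → ∃ λ l → g ≃ nbr l h
  f-nbr⁻ {g} {h} {i} fg≃ifh = Adj⇒nbr (f-adj⁻ h g (nbr⇒Adj i fg≃ifh))

  Fixed : V → Set
  Fixed g = f g ≃ g

  FixedNbhd : V → Set
  FixedNbhd g = Fixed g × (∀ i → Fixed (nbr i g))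

  image-of-nbr : ∀ {h} → Fixed h → ∀ i → ∃ λ l → f (nbr i h) ≃ nbr l h
  image-of-nbr {h} fh i with f-nbr i h
  ... | l , E = l , ≃-trans E (nbr-cong l fh)

  image-of-nbr-unique : ∀ {h a l} → f (nbr a h) ≃ nbr l h → Fixed (nbr l h) → a ≡ l
  image-of-nbr-unique E fl = nbr-injectiveˡ (f-≃⁻ (≃-trans E (≃-sym fl)))

  -- Were l far from b, the second common neighbour b (l h) of l h ≃ f (a h) and
  -- b h ≃ f (b h) would pull back to a second common neighbour of a h and b h.
  image-of-nbr-Near : ∀ {h a b l} → Fixed h → Near (toℕ a) (toℕ b) → Fixed (nbr b h) →
                      f (nbr a h) ≃ nbr l h → Near (toℕ l) (toℕ b)
  image-of-nbr-Near {h} {a} {b} {l} fh a~b fb E with ≡⊎Near⊎Far (toℕ l) (toℕ b)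
  ... | inj₁ l≡b with toℕ-injective l≡b
  ...   | refl = ⊥-elim (Near⇒≢ a~b (cong toℕ (image-of-nbr-unique E fb)))
  image-of-nbr-Near _  _   _  _ | inj₂ (inj₁ l~b) = l~b
  image-of-nbr-Near {h} {a} {b} {l} fh a~b fb E | inj₂ (inj₂ l≁b) = ⊥-elim contradiction
    where
    w : V
    w = proj₁ (f-surj (nbr b (nbr l h)))
    fw≃bl : f w ≃ nbr b (nbr l h)
    fw≃bl = proj₂ (f-surj (nbr b (nbr l h)))
    contradiction : ⊥
    contradiction with f-nbr⁻ {i = b} (≃-trans fw≃bl (nbr-cong b (≃-sym E)))
                     | f-nbr⁻ {i = l} (≃-trans fw≃bl (≃-trans (≃-sym (nbr-comm h l≁b)) (nbr-cong l (≃-sym fb))))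
    ... | c , w≃ca | d , w≃db with nbr-square (Near⇒≢ a~b ∘ cong toℕ) (≃-trans (≃-sym w≃ca) w≃db)
    ...   | inj₁ (refl , _)    = nbr-nbr-≄ (Far⇒≢ (Far-sym l≁b) ∘ cong toℕ)
                                   (≃-trans (≃-sym fw≃bl) (≃-trans (f-≃ (≃-trans w≃ca (nbr-involutive a h))) fh))
    ...   | inj₂ (_ , _ , a≁b) = Near⇒¬Far a~b a≁b

  fixed-Far : ∀ {g i j} → FixedNbhd g → Far (toℕ j) (toℕ i) → Fixed (nbr j (nbr i g))
  fixed-Far {g} {i} {j} (fg , fnbr) j≁i
    with f-nbr j (nbr i g) | f-nbr i (nbr j g)
  ... | l , E | l′ , E′ with nbr-square (Far⇒≢ (Far-sym j≁i) ∘ cong toℕ) (≃-trans (≃-sym z≃li) z≃l′j)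
    where
    z≃li : f (nbr j (nbr i g)) ≃ nbr l (nbr i g)
    z≃li = ≃-trans E (nbr-cong l (fnbr i))
    z≃l′j : f (nbr j (nbr i g)) ≃ nbr l′ (nbr j g)
    z≃l′j = ≃-trans (f-≃ (nbr-comm g j≁i)) (≃-trans E′ (nbr-cong l′ (fnbr j)))
  ...   | inj₁ (refl , _) = ⊥-elim (nbr-nbr-≄ (Far⇒≢ j≁i ∘ cong toℕ)
                              (f-≃⁻ (≃-trans (≃-trans E (nbr-cong i (fnbr i)))
                                             (≃-trans (nbr-involutive i g) (≃-sym fg)))))
  ...   | inj₂ (refl , _ , _) = ≃-trans E (nbr-cong j (fnbr i))

  fixed-nbr-self : ∀ {g} i → FixedNbhd g → Fixed (nbr i (nbr i g))
  fixed-nbr-self {g} i (fg , _) = ≃-trans (f-≃ (nbr-involutive i g)) (≃-trans fg (≃-sym (nbr-involutive i g)))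

  pinned-from-above : ∀ {h a b} → Fixed h → suc (toℕ a) ≡ toℕ b → Fixed (nbr b h) →
                      (∀ c → toℕ c ≡ suc (toℕ b) → Fixed (nbr c h)) → Fixed (nbr a h)
  pinned-from-above {h} {a} {b} fh sa≡b fb fabove with image-of-nbr fh a
  ... | l , E with l Fin.≟ a
  ...   | yes refl = E
  ...   | no  l≢a  = ⊥-elim (l≢a (sym (image-of-nbr-unique E (fabove l
                       (Near-other-above sa≡b (image-of-nbr-Near fh (inj₁ sa≡b) fb E) (l≢a ∘ toℕ-injective))))))

  pinned-from-below : ∀ {h a b} → Fixed h → toℕ a ≡ suc (toℕ b) → Fixed (nbr b h) →
                      (∀ c → suc (toℕ c) ≡ toℕ b → Fixed (nbr c h)) → Fixed (nbr a h)
  pinned-from-below {h} {a} {b} fh a≡sb fb fbelow with image-of-nbr fh a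
  ... | l , E with l Fin.≟ a
  ...   | yes refl = E
  ...   | no  l≢a  = ⊥-elim (l≢a (sym (image-of-nbr-unique E (fbelow l
                       (Near-other-below a≡sb (image-of-nbr-Near fh (inj₂ (sym a≡sb)) fb E) (l≢a ∘ toℕ-injective))))))

  fixed-above-interior : ∀ {g i j} → FixedNbhd g → toℕ j ≡ suc (toℕ i) → suc (toℕ j) < m →
                         Fixed (nbr j (nbr i g))
  fixed-above-interior {g} {i} {j} Fg j≡si sj<m =
    pinned-from-above (proj₂ Fg i) (sym b≡sj) (fixed-Far Fg (≤⇒Far ssi≤b))
      (λ c c≡sb → fixed-Far Fg (≤⇒Far (subst (suc (suc (toℕ i)) ≤_) (sym c≡sb) (m≤n⇒m≤1+n ssi≤b))))
    where
    b : Fin m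
    b = fromℕ< sj<m
    b≡sj : toℕ b ≡ suc (toℕ j)
    b≡sj = toℕ-fromℕ< sj<m
    ssi≤b : suc (suc (toℕ i)) ≤ toℕ b
    ssi≤b = ≤-reflexive (sym (trans b≡sj (cong suc j≡si)))

  fixed-below-interior : ∀ {g i j k} → FixedNbhd g → suc (toℕ j) ≡ toℕ i → toℕ j ≡ suc k →
                         Fixed (nbr j (nbr i g))
  fixed-below-interior {g} {i} {j} {k} Fg sj≡i j≡sk =
    pinned-from-below (proj₂ Fg i) (trans j≡sk (cong suc (sym b≡k))) (fixed-Far Fg (Far-sym (≤⇒Far ssb≤i)))
      (λ c sc≡b → fixed-Far Fg (Far-sym (≤⇒Far (subst (λ v → suc v ≤ toℕ i) (sym sc≡b) (<⇒≤ ssb≤i)))))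
    where
    k<m : k < m
    k<m = <-trans (subst (k <_) (sym j≡sk) (n<1+n k)) (toℕ<n j)
    b : Fin m
    b = fromℕ< k<m
    b≡k : toℕ b ≡ k
    b≡k = toℕ-fromℕ< k<m
    ssb≤i : suc (suc (toℕ b)) ≤ toℕ i
    ssb≤i = ≤-reflexive (trans (cong (suc ∘ suc) b≡k) (trans (cong suc (sym j≡sk)) sj≡i))

  -- For m = 3 no generator is far from 1, and the braid relation takes over: were
  -- 0 (1 g) sent to 2 (1 g), the vertex 1 (0 (1 g)) = 0 (1 (0 g)) would be sent to a
  -- common neighbour of 2 (1 g) and 1 (0 g), and these have none.
  fixed-hexagon : ∀ {g i c} → FixedNbhd g → m ≡ 3 → toℕ i ≡ 1 → toℕ c ≡ 0 → Fixed (nbr c (nbr i g))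
  fixed-hexagon {g} {i} {c} Fg m≡3 i≡1 c≡0 with image-of-nbr (proj₂ Fg i) c
  ... | l , E with image-of-nbr-Near (proj₂ Fg i) (inj₁ (trans (cong suc c≡0) (sym i≡1))) (fixed-nbr-self i Fg) E
  ...   | inj₁ sl≡i = subst (λ v → f (nbr c (nbr i g)) ≃ nbr v (nbr i g)) l≡c E
    where
    l≡c : l ≡ c
    l≡c = toℕ-injective (trans (suc-injective (trans sl≡i i≡1)) (sym c≡0))
  ...   | inj₂ si≡l = ⊥-elim (no-τ-hexagon (trans (sym si≡l) (cong suc i≡1)) i≡1 c≡0 (toℕ a) (toℕ b)
                        λ y y<4 → nbr*-≃⇒τ*-≗ (a ∷ l ∷ i ∷ []) (b ∷ i ∷ c ∷ []) g (≃-trans (≃-sym z≃al) z≃bc) y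
                                    (subst (y <_) (cong suc (sym m≡3)) y<4))
    where
    i≡sc : toℕ i ≡ suc (toℕ c)
    i≡sc = trans i≡1 (cong suc (sym c≡0))
    fixed-ic : Fixed (nbr i (nbr c g))
    fixed-ic = fixed-above-interior Fg i≡sc (subst₂ (λ u v → suc u < v) (sym i≡1) (sym m≡3) (s≤s (s≤s (s≤s z≤n))))
    z : V
    z = nbr i (nbr c (nbr i g))
    a : Fin m
    a = proj₁ (f-nbr i (nbr c (nbr i g)))
    b : Fin m
    b = proj₁ (f-nbr c (nbr i (nbr c g)))
    z≃al : f z ≃ nbr a (nbr l (nbr i g))
    z≃al = ≃-trans (proj₂ (f-nbr i (nbr c (nbr i g)))) (nbr-cong a E)
    z≃bc : f z ≃ nbr b (nbr i (nbr c g))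
    z≃bc = ≃-trans (f-≃ (≃-sym (nbr-braid g i≡sc)))
                   (≃-trans (proj₂ (f-nbr c (nbr i (nbr c g)))) (nbr-cong b fixed-ic))

  fixed-above : ∀ {g i j} → FixedNbhd g → toℕ j ≡ suc (toℕ i) → Fixed (nbr j (nbr i g))
  fixed-above {g} {i} {j} Fg j≡si with suc (toℕ j) <? m
  ... | yes sj<m = fixed-above-interior Fg j≡si sj<m
  ... | no  sj≮m = pinned-from-below (proj₂ Fg i) j≡si (fixed-nbr-self i Fg) fixed-below-i
    where
    m≡sj : m ≡ suc (toℕ j)
    m≡sj = ≤-antisym (≮⇒≥ sj≮m) (toℕ<n j)
    fixed-below-i : ∀ c → suc (toℕ c) ≡ toℕ i → Fixed (nbr c (nbr i g))
    fixed-below-i c sc≡i with toℕ c in c≡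
    ... | suc k = fixed-below-interior Fg (trans (cong suc c≡) sc≡i) c≡
    ... | zero  = fixed-hexagon Fg (trans m≡sj (cong suc (trans j≡si (cong suc (sym sc≡i))))) (sym sc≡i) c≡

  fixed-below : ∀ {g i j} → FixedNbhd g → suc (toℕ j) ≡ toℕ i → Fixed (nbr j (nbr i g))
  fixed-below {g} {i} {j} Fg sj≡i with toℕ j in j≡
  ... | suc k = fixed-below-interior Fg (trans (cong suc j≡) sj≡i) j≡
  ... | zero  = pinned-from-above (proj₂ Fg i) (trans (cong suc j≡) sj≡i) (fixed-nbr-self i Fg)
                  (λ c c≡si → fixed-above Fg c≡si)

  FixedNbhd-nbr : ∀ {g} i → FixedNbhd g → FixedNbhd (nbr i g)
  FixedNbhd-nbr {g} i Fg = proj₂ Fg i , λ j → by-position j (≡⊎Near⊎Far (toℕ j) (toℕ i))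
    where
    by-position : ∀ j → toℕ j ≡ toℕ i ⊎ Near (toℕ j) (toℕ i) ⊎ Far (toℕ j) (toℕ i) → Fixed (nbr j (nbr i g))
    by-position j (inj₁ j≡i) with toℕ-injective j≡i
    ... | refl = fixed-nbr-self i Fg
    by-position j (inj₂ (inj₁ (inj₁ sj≡i))) = fixed-below Fg sj≡i
    by-position j (inj₂ (inj₁ (inj₂ si≡j))) = fixed-above Fg (sym si≡j)
    by-position j (inj₂ (inj₂ j≁i))         = fixed-Far Fg j≁i

  FixedNbhd-resp : ∀ {g h} → g ≃ h → FixedNbhd g → FixedNbhd h
  FixedNbhd-resp g≃h (fg , fnbr) =
    ≃-trans (f-≃ (≃-sym g≃h)) (≃-trans fg g≃h) ,
    λ i → ≃-trans (f-≃ (nbr-cong i (≃-sym g≃h))) (≃-trans (fnbr i) (nbr-cong i g≃h))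

  -- Induction on d, using transpose p q = gen p ∘ transpose (p + 1) q ∘ gen p.
  FixedNbhd-transpose-< : ∀ d p q → toℕ q ≡ suc (toℕ p + d) → ∀ {g} → FixedNbhd g → FixedNbhd (g ∘ₚ transpose p q)
  FixedNbhd-transpose-< zero p q q≡sp {g} Fg =
    FixedNbhd-resp (≃-sym (∘ₚ-transpose-gen g i p q (sym i≡p) (trans q≡sp (cong suc (trans p+0≡p (sym i≡p))))))
      (FixedNbhd-nbr i Fg)
    where
    p+0≡p : toℕ p + 0 ≡ toℕ p
    p+0≡p = +-identityʳ (toℕ p)
    p<m : toℕ p < m
    p<m = ≤-pred (subst (_< suc m) (trans q≡sp (cong suc p+0≡p)) (toℕ<n q))
    i : Fin m
    i = fromℕ< p<m
    i≡p : toℕ i ≡ toℕ p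
    i≡p = toℕ-fromℕ< p<m
  FixedNbhd-transpose-< (suc d) p q q≡sp {g} Fg =
    FixedNbhd-resp (≃-sym (∘ₚ-transpose-conj g i p p′ q (sym i≡p) (trans p′≡sp (cong suc (sym i≡p))) sp<q))
      (FixedNbhd-nbr i (FixedNbhd-transpose-< d p′ q q≡sp′ (FixedNbhd-nbr i Fg)))
    where
    q≡ssp : toℕ q ≡ suc (suc (toℕ p + d))
    q≡ssp = trans q≡sp (cong suc (+-suc (toℕ p) d))
    sp<q : suc (toℕ p) < toℕ q
    sp<q = subst (suc (toℕ p) <_) (sym q≡ssp) (s≤s (s≤s (m≤m+n (toℕ p) d)))
    sp<sm : suc (toℕ p) < suc m
    sp<sm = <-trans sp<q (toℕ<n q)
    i : Fin m
    i = fromℕ< (≤-pred sp<sm)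
    i≡p : toℕ i ≡ toℕ p
    i≡p = toℕ-fromℕ< (≤-pred sp<sm)
    p′ : Fin (suc m)
    p′ = fromℕ< sp<sm
    p′≡sp : toℕ p′ ≡ suc (toℕ p)
    p′≡sp = toℕ-fromℕ< sp<sm
    q≡sp′ : toℕ q ≡ suc (toℕ p′ + d)
    q≡sp′ = trans q≡ssp (cong (λ v → suc (v + d)) (sym p′≡sp))

  FixedNbhd-transpose : ∀ p q {g} → FixedNbhd g → FixedNbhd (g ∘ₚ transpose p q)
  FixedNbhd-transpose p q {g} Fg with <-cmp (toℕ p) (toℕ q)
  ... | tri< p<q _ _ with m≤n⇒∃[o]m+o≡n p<q
  ...   | d , sp+d≡q = FixedNbhd-transpose-< d p q (sym sp+d≡q) Fg
  FixedNbhd-transpose p q {g} Fg | tri≈ _ p≡q _ with toℕ-injective p≡q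
  ...   | refl = FixedNbhd-resp (≃-sym (∘ₚ-transpose-same g p)) Fg
  FixedNbhd-transpose p q {g} Fg | tri> _ _ q<p with m≤n⇒∃[o]m+o≡n q<p
  ...   | d , sq+d≡p = FixedNbhd-resp (∘ₚ-transpose-comm g q p) (FixedNbhd-transpose-< d q p (sym sq+d≡p) Fg)

  FixedNbhd-∘ₚ-eval : ∀ xs {g} → FixedNbhd g → FixedNbhd (g ∘ₚ TL.eval xs)
  FixedNbhd-∘ₚ-eval []             Fg = FixedNbhd-resp (mk≃ λ _ → refl) Fg
  FixedNbhd-∘ₚ-eval ((p , q) ∷ xs) Fg =
    FixedNbhd-resp (mk≃ λ _ → refl) (FixedNbhd-∘ₚ-eval xs (FixedNbhd-transpose p q Fg))

  FixedNbhd-id⇒IsIdentity : FixedNbhd idₚ → IsIdentity φ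
  FixedNbhd-id⇒IsIdentity Fid π =
    ap (proj₁ (FixedNbhd-resp (mk≃ (TL.eval-decompose π)) (FixedNbhd-∘ₚ-eval (TL.decompose π) Fid)))

module IndicatorLabeling (G : Graph) (P : Graph.V G → Set) (P? : ∀ v → Dec (P v))
                         (P-resp : ∀ {u v} → Graph._≈_ G u v → P u → P v)
                         (≈-sym : ∀ {u v} → Graph._≈_ G u v → Graph._≈_ G v u) where

  open Graph G

  indicator : ∀ {A : Set} → Dec A → Fin 2
  indicator (yes _) = fsuc fzero
  indicator (no _)  = fzero

  labeling : Labeling G 2
  labeling = record { c = indicator ∘ P? ; c-cong = cong-P }
    where
    cong-P : ∀ {u v} → u ≈ v → indicator (P? u) ≡ indicator (P? v)
    cong-P {u} {v} u≈v with P? u | P? v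
    ... | yes _  | yes _  = refl
    ... | yes pu | no ¬pv = ⊥-elim (¬pv (P-resp u≈v pu))
    ... | no ¬pu | yes pv = ⊥-elim (¬pu (P-resp (≈-sym u≈v) pv))
    ... | no _   | no _   = refl

  same-label⇒P : ∀ {u v} → Labeling.c labeling u ≡ Labeling.c labeling v → P v → P u
  same-label⇒P {u} {v} eq pv with P? u | P? v
  ... | yes pu | _      = pu
  ... | no _   | yes _  = ⊥-elim (0≢1+n eq)
  ... | no _   | no ¬pv = ⊥-elim (¬pv pv)

τ-at-2≢0 : ∀ a → τ a 2 ≢ 0
τ-at-2≢0 zero          ()
τ-at-2≢0 (suc zero)    ()
τ-at-2≢0 (suc (suc a)) ()

no-τ-square : ∀ a b → ¬ (∀ y → y < 3 → τ a y ≡ τ b (τ 0 (τ 1 (τ 0 y))))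
no-τ-square zero    zero          E with E 0 (s≤s z≤n)
... | ()
no-τ-square zero    (suc zero)    E with E 1 (s≤s (s≤s z≤n))
... | ()
no-τ-square zero    (suc (suc b)) E with E 0 (s≤s z≤n)
... | ()
no-τ-square (suc a) zero          E with E 0 (s≤s z≤n)
... | ()
no-τ-square (suc a) (suc zero)    E with E 0 (s≤s z≤n)
... | ()
no-τ-square (suc a) (suc (suc b)) E with E 0 (s≤s z≤n)
... | ()

module Labelled (k : ℕ) where

  m : ℕ
  m = suc (suc k)

  open BubbleSortGraph m

  0F 1F : Fin m
  0F = fzero
  1F = fsuc fzero

  e s₀ x : V
  e  = idₚ
  s₀ = nbr 0F e
  x  = nbr 0F (nbr 1F s₀)

  InL : V → Set
  InL g = g ≃ e ⊎ g ≃ s₀ ⊎ g ≃ x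

  InL? : ∀ g → Dec (InL g)
  InL? g = (g ≃? e) ⊎-dec ((g ≃? s₀) ⊎-dec (g ≃? x))
    where
    _≃?_ : ∀ g h → Dec (g ≃ h)
    g ≃? h = map′ mk≃ ap (all? λ i → g ⟨$⟩ʳ i Fin.≟ h ⟨$⟩ʳ i)

  InL-resp : ∀ {g h} → g ≃ h → InL g → InL h
  InL-resp g≃h (inj₁ g≃e)        = inj₁ (≃-trans (≃-sym g≃h) g≃e)
  InL-resp g≃h (inj₂ (inj₁ g≃s)) = inj₂ (inj₁ (≃-trans (≃-sym g≃h) g≃s))
  InL-resp g≃h (inj₂ (inj₂ g≃x)) = inj₂ (inj₂ (≃-trans (≃-sym g≃h) g≃x))

  open IndicatorLabeling (BubbleSort (suc m)) InL InL? (InL-resp ∘ mk≃) (λ u≈v i → sym (u≈v i)) public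

  y<3⇒y<n : ∀ {y} → y < 3 → y < suc m
  y<3⇒y<n (s≤s z≤n)             = s≤s z≤n
  y<3⇒y<n (s≤s (s≤s z≤n))       = s≤s (s≤s z≤n)
  y<3⇒y<n (s≤s (s≤s (s≤s z≤n))) = s≤s (s≤s (s≤s z≤n))

  e≄x : ¬ e ≃ x
  e≄x E with nbr*-≃⇒τ*-≗ [] (0F ∷ 1F ∷ 0F ∷ []) e E 0 (s≤s z≤n)
  ... | ()

  s₀≄x : ¬ s₀ ≃ x
  s₀≄x E with nbr*-≃⇒τ*-≗ (0F ∷ []) (0F ∷ 1F ∷ 0F ∷ []) e E 0 (s≤s z≤n)
  ... | ()

  e≄nbr-x : ∀ a → ¬ e ≃ nbr a x
  e≄nbr-x a E = τ-at-2≢0 (toℕ a) (sym (nbr*-≃⇒τ*-≗ [] (a ∷ 0F ∷ 1F ∷ 0F ∷ []) e E 0 (s≤s z≤n)))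

  no-common-nbr-e-x : ∀ a b → ¬ nbr a e ≃ nbr b x
  no-common-nbr-e-x a b E =
    no-τ-square (toℕ a) (toℕ b) λ y y<3 → nbr*-≃⇒τ*-≗ (a ∷ []) (b ∷ 0F ∷ 1F ∷ 0F ∷ []) e E y (y<3⇒y<n y<3)

  InL⇒¬nbr-x : ∀ {u} a → InL u → ¬ u ≃ nbr a x
  InL⇒¬nbr-x a (inj₁ u≃e)        E = e≄nbr-x a (≃-trans (≃-sym u≃e) E)
  InL⇒¬nbr-x a (inj₂ (inj₁ u≃s)) E = no-common-nbr-e-x 0F a (≃-trans (≃-sym u≃s) E)
  InL⇒¬nbr-x a (inj₂ (inj₂ u≃x)) E = nbr-≄ (≃-trans (≃-sym E) u≃x)

  module _ (φ : Automorphism (BubbleSort (suc m))) (pres : Preserves φ labeling) where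

    open Rigidity m φ
    open Automorphism φ using (f)

    f-InL : ∀ {u} → InL u → InL (f u)
    f-InL {u} = same-label⇒P (pres u)

    preimage-InL : ∀ {v} → InL v → ∃ λ u → f u ≃ v × InL u
    preimage-InL {v} Lv with f-surj v
    ... | u , fu≃v = u , fu≃v , same-label⇒P (sym (pres u)) (InL-resp (≃-sym fu≃v) Lv)

    -- Of the vertices labelled 1, only x has no neighbour labelled 1.
    fixed-x : Fixed x
    fixed-x with f-InL {x} (inj₂ (inj₂ ≃-refl))
    ... | inj₂ (inj₂ fx≃x) = fx≃x
    ... | inj₁ fx≃e with preimage-InL {s₀} (inj₂ (inj₁ ≃-refl))
    ...   | u , fu≃s , Lu with f-nbr⁻ {i = 0F} (≃-trans fu≃s (nbr-cong 0F (≃-sym fx≃e)))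
    ...     | l , u≃lx = ⊥-elim (InL⇒¬nbr-x l Lu u≃lx)
    fixed-x | inj₂ (inj₁ fx≃s) with preimage-InL {e} (inj₁ ≃-refl)
    ...   | u , fu≃e , Lu
            with f-nbr⁻ {i = 0F} (≃-trans fu≃e (≃-trans (≃-sym (nbr-involutive 0F e)) (nbr-cong 0F (≃-sym fx≃s))))
    ...     | l , u≃lx = ⊥-elim (InL⇒¬nbr-x l Lu u≃lx)

    -- s₀ and x have the common neighbour 1 s₀, while e and x have none.
    fixed-e : Fixed e
    fixed-e with f-InL {e} (inj₁ ≃-refl)
    ... | inj₁ fe≃e = fe≃e
    ... | inj₂ (inj₂ fe≃x) = ⊥-elim (e≄x (f-≃⁻ (≃-trans fe≃x (≃-sym fixed-x))))
    ... | inj₂ (inj₁ fe≃s) with f-surj (nbr 1F s₀)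
    ...   | u , fu≃w
            with f-nbr⁻ {i = 1F} (≃-trans fu≃w (nbr-cong 1F (≃-sym fe≃s)))
               | f-nbr⁻ {i = 0F} (≃-trans fu≃w (≃-trans (≃-sym (nbr-involutive 0F (nbr 1F s₀)))
                                                        (nbr-cong 0F (≃-sym fixed-x))))
    ...     | a , u≃ae | b , u≃bx = ⊥-elim (no-common-nbr-e-x a b (≃-trans (≃-sym u≃ae) u≃bx))

    fixed-s₀ : Fixed s₀
    fixed-s₀ with f-InL {s₀} (inj₂ (inj₁ ≃-refl))
    ... | inj₁ fs≃e        = ⊥-elim (nbr-≄ (f-≃⁻ (≃-trans fs≃e (≃-sym fixed-e))))
    ... | inj₂ (inj₁ fs≃s) = fs≃s
    ... | inj₂ (inj₂ fs≃x) = ⊥-elim (s₀≄x (f-≃⁻ (≃-trans fs≃x (≃-sym fixed-x))))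

    fixed-nbr-e : ∀ j (i : Fin m) → toℕ i ≤ j → Fixed (nbr i e)
    fixed-nbr-e zero    fzero z≤n  = fixed-s₀
    fixed-nbr-e (suc j) i     i≤sj with m≤n⇒m<n∨m≡n i≤sj
    ... | inj₁ i<sj = fixed-nbr-e j i (≤-pred i<sj)
    ... | inj₂ i≡sj =
      pinned-from-below fixed-e (trans i≡sj (cong suc (sym b≡j))) (fixed-nbr-e j b (≤-reflexive b≡j))
        (λ c sc≡b → fixed-nbr-e j c (<⇒≤ (subst (toℕ c <_) (trans sc≡b b≡j) (n<1+n (toℕ c)))))
      where
      j<m : j < m
      j<m = <-trans (n<1+n j) (subst (_< m) i≡sj (toℕ<n i))
      b : Fin m
      b = fromℕ< j<m
      b≡j : toℕ b ≡ j
      b≡j = toℕ-fromℕ< j<m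

    FixedNbhd-e : FixedNbhd e
    FixedNbhd-e = fixed-e , λ i → fixed-nbr-e (toℕ i) i ≤-refl

  distinguishing : IsDistinguishing labeling
  distinguishing φ pres = Rigidity.FixedNbhd-id⇒IsIdentity m φ (FixedNbhd-e φ pres)

-- Precomposition g ↦ g ∘ π commutes with the left multiplications that define the edges.
precompose : ∀ {n} {S : List (Permutation′ n)} → Permutation′ n → Automorphism (Cay n S)
precompose π = record
  { f            = π ∘ₚ_
  ; f-cong       = λ a≈b x → a≈b (π ⟨$⟩ʳ x)
  ; f-injective  = λ {a} {b} πa≈πb x → trans (cong (a ⟨$⟩ʳ_) (sym (inverseʳ π)))
                                         (trans (πa≈πb (π ⟨$⟩ˡ x)) (cong (b ⟨$⟩ʳ_) (inverseʳ π)))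
  ; f-surjective = λ b → flip π ∘ₚ b , λ x → cong (b ⟨$⟩ʳ_) (inverseˡ π)
  ; f-adj        = λ a b (s , s∈S , E) → s , s∈S , λ x → E (π ⟨$⟩ʳ x)
  ; f-adj⁻       = λ a b (s , s∈S , E) → s , s∈S , λ x →
                     trans (cong (b ⟨$⟩ʳ_) (sym (inverseʳ π)))
                       (trans (E (π ⟨$⟩ˡ x)) (cong (λ y → s ⟨$⟩ʳ (a ⟨$⟩ʳ y)) (inverseʳ π)))
  }

¬Distinguishable-0 : ∀ {G} → Graph.V G → ¬ Distinguishable G 0
¬Distinguishable-0 v (L , _) with Labeling.c L v
... | ()

¬Distinguishable-Cay-1 : ∀ {n S} (π : Permutation′ n) (i : Fin n) → π ⟨$⟩ʳ i ≢ i → ¬ Distinguishable (Cay n S) 1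
¬Distinguishable-Cay-1 π i πi≢i (L , distinguishing) =
  πi≢i (distinguishing (precompose π) (λ _ → all-equal _ _) idₚ i)
  where
  all-equal : (a b : Fin 1) → a ≡ b
  all-equal fzero fzero = refl

mainTheorem7 : ∀ (n : ℕ) → 3 ≤ n → DistinguishingNumber≡ (BubbleSort n) 2
mainTheorem7 (suc (suc (suc k))) _ = (labeling , distinguishing) , fewer
  where
  open Labelled k
  fewer : ∀ r → r < 2 → ¬ Distinguishable (BubbleSort (suc m)) r
  fewer zero          _ = ¬Distinguishable-0 idₚ
  fewer (suc zero)    _ = ¬Distinguishable-Cay-1 (transpose fzero (fsuc fzero)) fzero (λ ())
  fewer (suc (suc r)) (s≤s (s≤s ()))
mainTheorem7 (suc zero)       (s≤s ())
mainTheorem7 (suc (suc zero)) (s≤s (s≤s ()))
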